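{- If $G$ is a chordal graph, then $\mu^{ - }(G)\le \omega(G)$.
   Context: All graphs are simple and undirected. A graph is chordal if every induced cycle is a triangle; $\omega(G)$ is the largest order of a complete subgraph of $G$. For $X\subseteq V(G)$, two vertices $a,b$ are $X$-visible if there is a shortest $a,b$-path $P$ in $G$ with $V(P)\cap X\subseteq\{a,b\}$. A set $X$ is a mutual-visibility set if every two vertices of $X$ are $X$-visible; it is maximal if no proper superset is a mutual-visibility set. The lower mutual-visibility number $\mu^{ - }(G)$ is the minimum cardinality of a maximal mutual-visibility set of $G$. -}

module Defs where

open import Data.Nat using (ℕ; zero; suc; _≤_; _%_)
open import Data.Fin using (Fin; toℕ)
open import Data.Fin.Subset using (Subset; _∈_; _⊆_; ∣_∣)
open import Data.Bool using (Bool; true; false)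
open import Data.List using (List; []; _∷_)
open import Data.List.Relation.Unary.Unique.Propositional using (Unique)
open import Data.Product using (Σ; _×_; ∃)
open import Data.Sum using (_⊎_)
open import Relation.Binary.PropositionalEquality using (_≡_; _≢_)
open import Function.Definitions using (Injective)
open import Function.Bundles using (_⇔_)
import Data.List.Membership.Propositional as LM

record Graph (n : ℕ) : Set where
  field
    Adj    : Fin n → Fin n → Bool
    sym    : ∀ u v → Adj u v ≡ Adj v u
    irrefl : ∀ v → Adj v v ≡ false

open Graph public

module _ {n : ℕ} (G : Graph n) where

  Edge : Fin n → Fin n → Set
  Edge u v = Adj G u v ≡ true

  data Walk : Fin n → Fin n → Set where
    [_]  : (a : Fin n) → Walk a a
    _∷⟨_⟩_ : (a : Fin n) {b c : Fin n} → Edge a b → Walk b c → Walk a c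

  vertices : ∀ {a b} → Walk a b → List (Fin n)
  vertices [ a ] = a ∷ []
  vertices (a ∷⟨ _ ⟩ w) = a ∷ vertices w

  len : ∀ {a b} → Walk a b → ℕ
  len [ a ] = zero
  len (a ∷⟨ _ ⟩ w) = suc (len w)

  IsPath : ∀ {a b} → Walk a b → Set
  IsPath w = Unique (vertices w)

  IsShortestPath : ∀ {a b} → Walk a b → Set
  IsShortestPath {a} {b} P =
    IsPath P × ((Q : Walk a b) → IsPath Q → len P ≤ len Q)

  Visible : Subset n → Fin n → Fin n → Set
  Visible X a b = Σ (Walk a b) λ P → IsShortestPath P ×
    (∀ v → v LM.∈ vertices P → v ∈ X → v ≡ a ⊎ v ≡ b)

  IsMutualVisibilitySet : Subset n → Set
  IsMutualVisibilitySet X = ∀ a b → a ∈ X → b ∈ X → Visible X a b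

  IsMaximalMutualVisibilitySet : Subset n → Set
  IsMaximalMutualVisibilitySet X = IsMutualVisibilitySet X ×
    (∀ Y → X ⊆ Y → IsMutualVisibilitySet Y → Y ≡ X)

  IsClique : Subset n → Set
  IsClique K = ∀ u v → u ∈ K → v ∈ K → u ≢ v → Edge u v

  CycNext : (m : ℕ) → Fin (suc (suc (suc m))) → Fin (suc (suc (suc m))) → Set
  CycNext m i j = toℕ j ≡ suc (toℕ i) % suc (suc (suc m))

  -- c : Fin (3+m) → V lists the vertices of an induced cycle of length 3+m
  IsInducedCycle : (m : ℕ) → (Fin (suc (suc (suc m))) → Fin n) → Set
  IsInducedCycle m c = Injective _≡_ _≡_ c ×
    (∀ i j → Edge (c i) (c j) ⇔ (CycNext m i j ⊎ CycNext m j i))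

  -- chordal: every induced cycle is a triangle
  IsChordal : Set
  IsChordal = ∀ m c → IsInducedCycle m c → m ≡ 0

-- Every chordal graph with a vertex has a simplicial vertex v. This is a form of
-- Dirac's lemma, proved by induction on vertex sets U: suppose a ∈ U has a
-- non-neighbour w but no non-neighbour simplicial in G[U]. Let C be the component
-- of w in G[U] − N[a] and S the neighbours of a adjacent to C. Two non-adjacent
-- vertices of S would be joined through C by a walk avoiding N[a], and a shortest
-- one would close through a into an induced cycle of length ≥ 4, so S is a clique.
-- A vertex of C simplicial in G[C ∪ S] is simplicial in G[U], as its neighbours
-- all lie in C ∪ S; so by induction no vertex of C ∪ S has a non-neighbour there,
-- and w is simplicial after all.
-- N[v] is then a clique, hence a mutual-visibility set, and it is maximal: every
-- path from v leaving N[v] passes through N(v).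
-- Classical steps run in the double-negation monad; v is extracted at the end
-- because simpliciality is decidable.

module Submission where

open import Defs
open import Data.Nat using (ℕ; _≤_)
open import Data.Fin.Subset using (Subset; ∣_∣)
open import Data.Product using (Σ; _×_)

open import Data.Nat using (zero; suc; _<_; _+_; _∸_; _%_; z≤n; s≤s; _≤?_)
open import Data.Nat.Properties
  using (≤-refl; <⇒≤; <-trans; <-≤-trans; <-cmp; n<1+n; m<n⇒m<1+n; <⇒≱; ≤∧≢⇒<; m≤n⇒m<n∨m≡n;
         m≤m+n; m<m+n; +-monoˡ-<; m+[n∸m]≡n; m∸n+n≡m; m∸n≤m; ≤-trans; m<n⇒0<n∸m; m+n≤o⇒m≤o∸n;
         ≰⇒>; ≤-pred; 1+n≰n; <⇒≢)
  renaming (_≟_ to _≟ℕ_)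
open import Data.Nat.DivMod using (m≤n⇒m%n≡m; n%n≡0)
open import Data.Nat.Induction using (<-rec)
open import Data.Fin using (Fin; toℕ; _≟_)
open import Data.Fin.Properties using (toℕ-injective; toℕ≤pred[n]; any?; all?)
open import Data.Fin.Subset using (_∈_; _∉_; _⊆_; _⊂_; _∪_; ⊤; inside; outside)
open import Data.Fin.Subset.Properties using (_∈?_; ∈⊤; x∈p∪q⁺; x∈p∪q⁻; ⊆-antisym; drop-there)
open import Data.Fin.Subset.Induction using (⊂-wellFounded; Acc; acc)
open import Data.Vec using ([]; _∷_; here; there)
open import Data.Bool using (true; if_then_else_)
open import Data.Bool.Properties using () renaming (_≟_ to _≟𝔹_)
open import Data.Product using (_,_; proj₁; proj₂)
open import Data.Sum using (_⊎_; inj₁; inj₂; [_,_]′)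
import Data.Sum as Sum
open import Data.Empty using (⊥)
open import Data.List.Relation.Unary.All using ([]; _∷_)
open import Data.List.Relation.Unary.AllPairs using ([]; _∷_)
open import Data.List.Relation.Unary.Any using (here; there)
import Data.List.Membership.Propositional as List
open import Function using (_∘_; _⇔_; mk⇔; Equivalence)
open Equivalence using (to; from)
open import Relation.Binary.Definitions using (tri<; tri≈; tri>)
open import Relation.Binary.Construct.Closure.ReflexiveTransitive using (Star; ε; _◅_; _◅◅_; reverse)
open import Relation.Nullary using (¬_; Dec; yes; no; does; contradiction)
open import Relation.Nullary.Decidable
  using (_⊎-dec_; _→-dec_; ¬?; decidable-stable; ¬¬-excluded-middle; dec-true; dec-false)
open import Relation.Nullary.Negation using (¬¬-map)
import Relation.Binary.PropositionalEquality as ≡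
open ≡ using (_≡_; refl; trans; cong; subst; subst₂; _≢_; ≢-sym)

¬¬-decidable : ∀ {n} (P : Fin n → Set) → ¬ ¬ (∀ v → Dec (P v))
¬¬-decidable {zero} P k = k λ ()
¬¬-decidable {suc n} P k =
  ¬¬-excluded-middle λ P₀? → ¬¬-decidable (P ∘ Fin.suc) λ P₊? →
    k λ { Fin.zero → P₀? ; (Fin.suc v) → P₊? v }

comprehension : ∀ {n} {P : Fin n → Set} → (∀ v → Dec (P v)) →
  Σ (Subset n) λ X → ∀ v → v ∈ X ⇔ P v
comprehension {zero} P? = [] , λ ()
comprehension {suc n} P? with comprehension (P? ∘ Fin.suc)
... | X , X⇔ with P? Fin.zero
...   | yes p₀ = inside ∷ X , λ where
          Fin.zero → mk⇔ (λ _ → p₀) (λ _ → here)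
          (Fin.suc v) → mk⇔ (to (X⇔ v) ∘ drop-there) (there ∘ from (X⇔ v))
...   | no ¬p₀ = outside ∷ X , λ where
          Fin.zero → mk⇔ (λ ()) (λ p₀ → contradiction p₀ ¬p₀)
          (Fin.suc v) → mk⇔ (to (X⇔ v) ∘ drop-there) (there ∘ from (X⇔ v))

¬¬-comprehension : ∀ {n} (P : Fin n → Set) → ¬ ¬ Σ (Subset n) λ X → ∀ v → v ∈ X ⇔ P v
¬¬-comprehension P = ¬¬-map comprehension (¬¬-decidable P)

data Position (L : ℕ) : ℕ → Set where
  first  : Position L 0
  last   : Position L L
  middle : ∀ {i} → suc i < L → Position L (suc i)

position : ∀ {L i} → i ≤ L → Position L i
position {i = zero} _ = first
position {L} {suc i} i≤L with suc i ≟ℕ L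
... | yes refl = last
... | no i≢L = middle (≤∧≢⇒< i≤L i≢L)

module _ {n : ℕ} (G : Graph n) where

  Edge-sym : ∀ {u v} → Edge G u v → Edge G v u
  Edge-sym {u} {v} e = trans (sym G v u) e

  Edge-irrefl : ∀ {v} → ¬ Edge G v v
  Edge-irrefl {v} e = contradiction (trans (≡.sym e) (irrefl G v)) λ ()

  Edge⇒≢ : ∀ {u v} → Edge G u v → u ≢ v
  Edge⇒≢ e refl = Edge-irrefl e

  Edge? : ∀ u v → Dec (Edge G u v)
  Edge? u v = Adj G u v ≟𝔹 true

  Far : Fin n → Fin n → Set
  Far a v = v ≢ a × ¬ Edge G a v

  prepend : Fin n → (ℕ → Fin n) → ℕ → Fin n
  prepend x p zero = x
  prepend x p (suc k) = p k

  -- Walks are index functions, so that shortcutting a walk is reindexing.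
  record WalkThrough (P : Fin n → Set) (s t : Fin n) (L : ℕ) (p : ℕ → Fin n) : Set where
    field
      start : p 0 ≡ s
      end   : p L ≡ t
      step  : ∀ {i} → i < L → Edge G (p i) (p (suc i))
      inner : ∀ {i} → suc i < L → P (p (suc i))

  open WalkThrough

  Shortcut : ℕ → (ℕ → Fin n) → Set
  Shortcut L p = Σ ℕ λ i → Σ ℕ λ j → suc i < j × j ≤ L × (p i ≡ p j ⊎ Edge G (p i) (p j))

  module _ {P : Fin n → Set} where

    edge-walk : ∀ {s t} → Edge G s t → WalkThrough P s t 1 (prepend s λ _ → t)
    edge-walk e = record
      { start = refl ; end = refl ; step = λ { {zero} _ → e ; {suc _} (s≤s ()) } ; inner = λ { (s≤s ()) } }

    cons-walk : ∀ {s u t L p} → Edge G s u → P u → WalkThrough P u t L p →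
      WalkThrough P s t (suc L) (prepend s p)
    cons-walk {s} {L = L} {p} e Pu W = record
      { start = refl ; end = end W ; step = step′ ; inner = inner′ }
      where
      step′ : ∀ {i} → i < suc L → Edge G (prepend s p i) (p i)
      step′ {zero} _ = subst (Edge G s) (≡.sym (start W)) e
      step′ {suc i} (s≤s i<L) = step W i<L
      inner′ : ∀ {i} → suc i < suc L → P (p i)
      inner′ {zero} _ = subst P (≡.sym (start W)) Pu
      inner′ {suc i} (s≤s i<L) = inner W i<L

    Link : Fin n → Fin n → Set
    Link u v = P u × Edge G u v × P v

    Link-sym : ∀ {u v} → Link u v → Link v u
    Link-sym (Pu , e , Pv) = Pv , Edge-sym e , Pu

    Star-end : ∀ {u v} → P u → Star Link u v → P v
    Star-end Pu ε = Pu
    Star-end _ ((_ , _ , Pv) ◅ r) = Star-end Pv r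

    WalkThrough-map : ∀ {Q : Fin n → Set} {s t L p} → (∀ {v} → P v → Q v) →
      WalkThrough P s t L p → WalkThrough Q s t L p
    WalkThrough-map P⇒Q W = record
      { start = start W ; end = end W ; step = step W ; inner = P⇒Q ∘ inner W }

    star⇒walk : ∀ {s c c′ t} → Edge G s c → P c → Star Link c c′ → Edge G c′ t →
      Σ ℕ λ L → Σ (ℕ → Fin n) (WalkThrough P s t L)
    star⇒walk e Pc ε e′ = _ , _ , cons-walk e Pc (edge-walk e′)
    star⇒walk e Pc ((_ , e₁ , Pv) ◅ r) e′ =
      let L , p , W = star⇒walk e₁ Pv r e′ in suc L , _ , cons-walk e Pc W

    truncate-walk : ∀ {s t L p i} → WalkThrough P s t L p → i ≤ L → p i ≡ t → WalkThrough P s t i p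
    truncate-walk W i≤L pi≡t = record
      { start = start W
      ; end = pi≡t
      ; step = λ k<i → step W (<-≤-trans k<i i≤L)
      ; inner = λ k<i → inner W (<-≤-trans k<i i≤L)
      }

    skipAfter : ℕ → ℕ → (ℕ → Fin n) → ℕ → Fin n
    skipAfter i d p k = if does (k ≤? i) then p k else p (k + d)

    skipAfter-≤ : ∀ {i k} d p → k ≤ i → skipAfter i d p k ≡ p k
    skipAfter-≤ {i} {k} _ _ k≤i rewrite dec-true (k ≤? i) k≤i = refl

    skipAfter-> : ∀ {i k} d p → i < k → skipAfter i d p k ≡ p (k + d)
    skipAfter-> {i} {k} _ _ i<k rewrite dec-false (k ≤? i) (<⇒≱ i<k) = refl

    skip-walk : ∀ {s t L d p i} → WalkThrough P s t (L + d) p → i < L →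
      Edge G (p i) (p (suc i + d)) → WalkThrough P s t L (skipAfter i d p)
    skip-walk {L = L} {d} {p} {i} W i<L chord = record
      { start = trans (kept z≤n) (start W)
      ; end = trans (shifted i<L) (end W)
      ; step = step′
      ; inner = inner′
      }
      where
      q = skipAfter i d p
      kept : ∀ {k} → k ≤ i → q k ≡ p k
      kept = skipAfter-≤ d p
      shifted : ∀ {k} → i < k → q k ≡ p (k + d)
      shifted = skipAfter-> d p
      step′ : ∀ {k} → k < L → Edge G (q k) (q (suc k))
      step′ {k} k<L with <-cmp k i
      ... | tri< k<i _ _ = subst₂ (Edge G) (≡.sym (kept (<⇒≤ k<i))) (≡.sym (kept k<i))
                             (step W (<-≤-trans k<L (m≤m+n L d)))
      ... | tri≈ _ refl _ = subst₂ (Edge G) (≡.sym (kept ≤-refl)) (≡.sym (shifted (n<1+n k))) chord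
      ... | tri> _ _ i<k = subst₂ (Edge G) (≡.sym (shifted i<k)) (≡.sym (shifted (m<n⇒m<1+n i<k)))
                             (step W (+-monoˡ-< d k<L))
      inner′ : ∀ {k} → suc k < L → P (q (suc k))
      inner′ {k} k<L with suc k ≤? i
      ... | yes k≤i = subst P (≡.sym (kept k≤i)) (inner W (<-≤-trans k<L (m≤m+n L d)))
      ... | no k≰i = subst P (≡.sym (shifted (≰⇒> k≰i))) (inner W (+-monoˡ-< d k<L))

    ShorterWalk : Fin n → Fin n → ℕ → Set
    ShorterWalk s t L = Σ ℕ λ L′ → L′ < L × Σ (ℕ → Fin n) (WalkThrough P s t L′)

    chord⇒shorter : ∀ {s t L p i j} → WalkThrough P s t L p → suc i < j → j ≤ L →
      Edge G (p i) (p j) → ShorterWalk s t L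
    chord⇒shorter {s} {t} {L} {p} {i} {j} W i+1<j j≤L chord =
      L ∸ d , L∸d<L , _ , skip-walk W′ i<L∸d chord′
      where
      d = j ∸ suc i
      i+1+d≡j : suc i + d ≡ j
      i+1+d≡j = m+[n∸m]≡n (<⇒≤ i+1<j)
      L∸d+d≡L : L ∸ d + d ≡ L
      L∸d+d≡L = m∸n+n≡m (≤-trans (m∸n≤m j (suc i)) j≤L)
      W′ : WalkThrough P s t (L ∸ d + d) p
      W′ = subst (λ L → WalkThrough P s t L p) (≡.sym L∸d+d≡L) W
      i<L∸d : i < L ∸ d
      i<L∸d = m+n≤o⇒m≤o∸n (suc i) (subst (_≤ L) (≡.sym i+1+d≡j) j≤L)
      chord′ : Edge G (p i) (p (suc i + d))
      chord′ = subst (λ x → Edge G (p i) (p x)) (≡.sym i+1+d≡j) chord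
      L∸d<L : L ∸ d < L
      L∸d<L = subst (L ∸ d <_) L∸d+d≡L (m<m+n (L ∸ d) (m<n⇒0<n∸m i+1<j))

    -- A repeated vertex p i ≡ p j either ends the walk or makes (i, j + 1) a chord.
    shortcut⇒shorter : ∀ {s t L p} → WalkThrough P s t L p → Shortcut L p → ShorterWalk s t L
    shortcut⇒shorter W (i , j , i+1<j , j≤L , inj₂ chord) = chord⇒shorter W i+1<j j≤L chord
    shortcut⇒shorter {p = p} W (i , j , i+1<j , j≤L , inj₁ pi≡pj) with m≤n⇒m<n∨m≡n j≤L
    ... | inj₂ refl = i , i<j , _ , truncate-walk W (<⇒≤ i<j) (trans pi≡pj (end W))
      where i<j = <-trans (n<1+n i) i+1<j
    ... | inj₁ j<L = chord⇒shorter W (m<n⇒m<1+n i+1<j) j<L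
                       (subst (λ x → Edge G x (p (suc j))) (≡.sym pi≡pj) (step W j<L))

  CycSucc : ℕ → ℕ → ℕ → Set
  CycSucc top x y = y ≡ suc x ⊎ (x ≡ top × y ≡ 0)

  CycNext⇔CycSucc : ∀ m (i j : Fin (suc (suc (suc m)))) →
    CycNext G m i j ⇔ CycSucc (suc (suc m)) (toℕ i) (toℕ j)
  CycNext⇔CycSucc m i j with m≤n⇒m<n∨m≡n (toℕ≤pred[n] i)
  ... | inj₁ i<top = mk⇔ (λ j≡ → inj₁ (trans j≡ no-wrap))
    [ (λ j≡ → trans j≡ (≡.sym no-wrap)) , (λ (i≡top , _) → contradiction i≡top (<⇒≢ i<top)) ]′
    where
    no-wrap : suc (toℕ i) % suc (suc (suc m)) ≡ suc (toℕ i)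
    no-wrap = m≤n⇒m%n≡m i<top
  ... | inj₂ i≡top = mk⇔ (λ j≡ → inj₂ (i≡top , trans j≡ wrap))
    [ (λ j≡ → contradiction (subst (_≤ suc (suc m)) (trans j≡ (cong suc i≡top)) (toℕ≤pred[n] j)) 1+n≰n)
    , (λ (_ , j≡0) → trans j≡0 (≡.sym wrap)) ]′
    where
    wrap : suc (toℕ i) % suc (suc (suc m)) ≡ 0
    wrap = trans (cong (λ x → suc x % suc (suc (suc m))) i≡top) (n%n≡0 (suc (suc (suc m))))

  -- a followed by the walk is an induced cycle, which chordality makes a triangle.
  module InducedCycle (chordal : IsChordal G) {a s t m p}
    (a~s : Edge G a s) (a~t : Edge G a t) (W : WalkThrough (Far a) s t (suc m) p)
    (distinct : ∀ {i j} → i < j → j ≤ suc m → p i ≢ p j)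
    (chordless : ∀ {i j} → suc i < j → j ≤ suc m → ¬ Edge G (p i) (p j)) where

    q : ℕ → Fin n
    q = prepend a p

    walk≢a : ∀ {i} → i ≤ suc m → p i ≢ a
    walk≢a i≤ with position i≤
    ... | first = λ p0≡a → Edge⇒≢ a~s (≡.sym (trans (≡.sym (start W)) p0≡a))
    ... | last = λ pL≡a → Edge⇒≢ a~t (≡.sym (trans (≡.sym (end W)) pL≡a))
    ... | middle i< = proj₁ (inner W i<)

    a-adjacent⇒end : ∀ {i} → i ≤ suc m → Edge G a (p i) → i ≡ 0 ⊎ i ≡ suc m
    a-adjacent⇒end i≤ e with position i≤
    ... | first = inj₁ refl
    ... | last = inj₂ refl
    ... | middle i< = contradiction e (proj₂ (inner W i<))

    forward-adjacent : ∀ {i j} → i < j → j ≤ suc m → Edge G (p i) (p j) → j ≡ suc i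
    forward-adjacent i<j j≤ e with m≤n⇒m<n∨m≡n i<j
    ... | inj₁ i+1<j = contradiction e (chordless i+1<j j≤)
    ... | inj₂ i+1≡j = ≡.sym i+1≡j

    walk-adjacent : ∀ {i j} → i ≤ suc m → j ≤ suc m → Edge G (p i) (p j) → j ≡ suc i ⊎ i ≡ suc j
    walk-adjacent {i} {j} i≤ j≤ e with <-cmp i j
    ... | tri< i<j _ _ = inj₁ (forward-adjacent i<j j≤ e)
    ... | tri≈ _ refl _ = contradiction e Edge-irrefl
    ... | tri> _ _ j<i = inj₂ (forward-adjacent j<i i≤ (Edge-sym e))

    q-injective : ∀ {x y} → x ≤ suc (suc m) → y ≤ suc (suc m) → q x ≡ q y → x ≡ y
    q-injective {zero} {zero} _ _ _ = refl
    q-injective {zero} {suc y} _ (s≤s y≤) a≡ = contradiction (≡.sym a≡) (walk≢a y≤)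
    q-injective {suc x} {zero} (s≤s x≤) _ ≡a = contradiction ≡a (walk≢a x≤)
    q-injective {suc x} {suc y} (s≤s x≤) (s≤s y≤) e with <-cmp x y
    ... | tri< x<y _ _ = contradiction e (distinct x<y y≤)
    ... | tri≈ _ x≡y _ = cong suc x≡y
    ... | tri> _ _ y<x = contradiction (≡.sym e) (distinct y<x x≤)

    CycSucc⇒Edge : ∀ {x y} → y ≤ suc (suc m) → CycSucc (suc (suc m)) x y → Edge G (q x) (q y)
    CycSucc⇒Edge {zero} _ (inj₁ refl) = subst (Edge G a) (≡.sym (start W)) a~s
    CycSucc⇒Edge {suc x} y≤ (inj₁ refl) = step W (≤-pred y≤)
    CycSucc⇒Edge _ (inj₂ (refl , refl)) = subst (λ v → Edge G v a) (≡.sym (end W)) (Edge-sym a~t)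

    a-Edge⇒CycSucc : ∀ {y} → y ≤ suc m → Edge G a (p y) →
      CycSucc (suc (suc m)) 0 (suc y) ⊎ CycSucc (suc (suc m)) (suc y) 0
    a-Edge⇒CycSucc y≤ e with a-adjacent⇒end y≤ e
    ... | inj₁ refl = inj₁ (inj₁ refl)
    ... | inj₂ refl = inj₂ (inj₂ (refl , refl))

    Edge⇒CycSucc : ∀ {x y} → x ≤ suc (suc m) → y ≤ suc (suc m) → Edge G (q x) (q y) →
      CycSucc (suc (suc m)) x y ⊎ CycSucc (suc (suc m)) y x
    Edge⇒CycSucc {zero} {zero} _ _ e = contradiction e Edge-irrefl
    Edge⇒CycSucc {zero} {suc y} _ (s≤s y≤) e = a-Edge⇒CycSucc y≤ e
    Edge⇒CycSucc {suc x} {zero} (s≤s x≤) _ e = Sum.swap (a-Edge⇒CycSucc x≤ (Edge-sym e))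
    Edge⇒CycSucc {suc x} {suc y} (s≤s x≤) (s≤s y≤) e with walk-adjacent x≤ y≤ e
    ... | inj₁ refl = inj₁ (inj₁ refl)
    ... | inj₂ refl = inj₂ (inj₁ refl)

    induced : IsInducedCycle G m (q ∘ toℕ)
    induced = (λ e → toℕ-injective (q-injective (toℕ≤pred[n] _) (toℕ≤pred[n] _) e)) , λ i j →
      mk⇔ (Sum.map (from (CycNext⇔CycSucc m i j)) (from (CycNext⇔CycSucc m j i))
            ∘ Edge⇒CycSucc (toℕ≤pred[n] i) (toℕ≤pred[n] j))
          [ CycSucc⇒Edge (toℕ≤pred[n] j) ∘ to (CycNext⇔CycSucc m i j)
          , Edge-sym ∘ CycSucc⇒Edge (toℕ≤pred[n] i) ∘ to (CycNext⇔CycSucc m j i) ]′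

    s~t : Edge G s t
    s~t = subst₂ (Edge G) (start W) (trans (cong (p ∘ suc) (≡.sym (chordal m (q ∘ toℕ) induced))) (end W))
            (step W (s≤s z≤n))

  -- A shortest such walk has no shortcut, so it closes through a into an induced cycle.
  chordal-detour : IsChordal G → ∀ {a s t L p} → Edge G a s → Edge G a t → s ≢ t →
    WalkThrough (Far a) s t L p → Edge G s t
  chordal-detour chordal {a} {s} {t} a~s a~t s≢t W =
    decidable-stable (Edge? s t) (<-rec Goal go _ _ W)
    where
    Goal : ℕ → Set
    Goal L = ∀ p → WalkThrough (Far a) s t L p → ¬ ¬ Edge G s t

    shortcut-free⇒Edge : ∀ {L p} → WalkThrough (Far a) s t L p → ¬ Shortcut L p → Edge G s t
    shortcut-free⇒Edge {zero} W _ = contradiction (trans (≡.sym (start W)) (end W)) s≢t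
    shortcut-free⇒Edge {suc m} {p} W no-shortcut =
      InducedCycle.s~t chordal a~s a~t W distinct chordless
      where
      chordless : ∀ {i j} → suc i < j → j ≤ suc m → ¬ Edge G (p i) (p j)
      chordless i+1<j j≤ e = no-shortcut (_ , _ , i+1<j , j≤ , inj₂ e)
      distinct : ∀ {i j} → i < j → j ≤ suc m → p i ≢ p j
      distinct i<j j≤ pi≡pj with m≤n⇒m<n∨m≡n i<j
      ... | inj₁ i+1<j = no-shortcut (_ , _ , i+1<j , j≤ , inj₁ pi≡pj)
      ... | inj₂ refl = Edge⇒≢ (step W j≤) pi≡pj

    go : ∀ L → (∀ {L′} → L′ < L → Goal L′) → Goal L
    go L shorter p W ¬s~t = ¬¬-excluded-middle λ where
      (yes shortcut) →
        let L′ , L′<L , p′ , W′ = shortcut⇒shorter W shortcut in shorter L′<L p′ W′ ¬s~t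
      (no no-shortcut) → ¬s~t (shortcut-free⇒Edge W no-shortcut)

  Simplicial : Subset n → Fin n → Set
  Simplicial U v = ∀ x y → x ∈ U → y ∈ U → Edge G v x → Edge G v y → x ≢ y → Edge G x y

  simplicial? : ∀ U v → Dec (Simplicial U v)
  simplicial? U v = all? λ x → all? λ y →
    x ∈? U →-dec y ∈? U →-dec Edge? v x →-dec Edge? v y →-dec ¬? (x ≟ y) →-dec Edge? x y

  FarSimplicial : Subset n → Fin n → Set
  FarSimplicial U a = Σ (Fin n) λ v → v ∈ U × Far a v × Simplicial U v

  Far-sym : ∀ {a v} → Far a v → Far v a
  Far-sym (v≢a , ¬a~v) = ≢-sym v≢a , ¬a~v ∘ Edge-sym

  module Separation (U : Subset n) (a w : Fin n) where

    Outside : Fin n → Set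
    Outside v = v ∈ U × Far a v

    Component : Fin n → Set
    Component = Star (Link {Outside}) w

    Boundary : Fin n → Set
    Boundary s = s ∈ U × Edge G a s × Σ (Fin n) λ c → Component c × Edge G c s

    module Step (chordal : IsChordal G) (a∈U : a ∈ U) (w-outside : Outside w)
      (no-far-simplicial : ¬ FarSimplicial U a)
      (ih : ∀ {U′} → U′ ⊂ U → ∀ {b x} → b ∈ U′ → x ∈ U′ → Far b x → ¬ ¬ FarSimplicial U′ b)
      (C : Subset n) (∈C⇔ : ∀ v → v ∈ C ⇔ Component v)
      (S : Subset n) (∈S⇔ : ∀ v → v ∈ S ⇔ Boundary v) where

      U′ : Subset n
      U′ = C ∪ S

      ∈U′⁻ : ∀ {v} → v ∈ U′ → Component v ⊎ Boundary v
      ∈U′⁻ {v} = Sum.map (to (∈C⇔ v)) (to (∈S⇔ v)) ∘ x∈p∪q⁻ C S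

      component⇒∈U′ : ∀ {v} → Component v → v ∈ U′
      component⇒∈U′ {v} = x∈p∪q⁺ ∘ inj₁ ∘ from (∈C⇔ v)

      boundary⇒∈U′ : ∀ {v} → Boundary v → v ∈ U′
      boundary⇒∈U′ {v} = x∈p∪q⁺ ∘ inj₂ ∘ from (∈S⇔ v)

      component-outside : ∀ {v} → Component v → Outside v
      component-outside = Star-end w-outside

      U′⊂U : U′ ⊂ U
      U′⊂U = [ proj₁ ∘ component-outside , proj₁ ]′ ∘ ∈U′⁻ , a , a∈U ,
        [ (λ c → proj₁ (proj₂ (component-outside c)) refl) , (λ b → Edge-irrefl (proj₁ (proj₂ b))) ]′ ∘ ∈U′⁻

      component-closed : ∀ {v x} → Component v → x ∈ U → Edge G v x → x ∈ U′
      component-closed {v} {x} c x∈U v~x with x ≟ a | Edge? a x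
      ... | yes refl | _ = contradiction (Edge-sym v~x) (proj₂ (proj₂ (component-outside c)))
      ... | no x≢a | yes a~x = boundary⇒∈U′ (x∈U , a~x , v , c , v~x)
      ... | no x≢a | no ¬a~x = component⇒∈U′ (c ◅◅ (component-outside c , v~x , x∈U , x≢a , ¬a~x) ◅ ε)

      component-not-simplicial : ∀ {v} → Component v → ¬ Simplicial U′ v
      component-not-simplicial {v} c simplicial = no-far-simplicial
        (v , proj₁ (component-outside c) , proj₂ (component-outside c) ,
         λ x y x∈U y∈U v~x v~y →
           simplicial x y (component-closed c x∈U v~x) (component-closed c y∈U v~y) v~x v~y)

      boundary-clique : ∀ {s t} → Boundary s → Boundary t → s ≢ t → Edge G s t
      boundary-clique (_ , a~s , c , w⇝c , c~s) (_ , a~t , c′ , w⇝c′ , c′~t) s≢t =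
        let _ , _ , W = star⇒walk (Edge-sym c~s) (component-outside w⇝c)
                          (reverse Link-sym w⇝c ◅◅ w⇝c′) c′~t
        in chordal-detour chordal a~s a~t s≢t (WalkThrough-map proj₂ W)

      simplicial⇒boundary : ∀ {v} → v ∈ U′ → Simplicial U′ v → Boundary v
      simplicial⇒boundary v∈U′ simplicial =
        [ (λ c → contradiction simplicial (component-not-simplicial c)) , (λ b → b) ]′ (∈U′⁻ v∈U′)

      boundary-dominates : ∀ {s x} → Boundary s → x ∈ U′ → ¬ Far s x
      boundary-dominates bs x∈U′ far =
        ih U′⊂U (boundary⇒∈U′ bs) x∈U′ far λ (v , v∈U′ , far-v , simplicial) →
          proj₂ far-v (boundary-clique bs (simplicial⇒boundary v∈U′ simplicial) (≢-sym (proj₁ far-v)))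

      U′-clique : IsClique G U′
      U′-clique x y x∈U′ y∈U′ x≢y = decidable-stable (Edge? x y) λ ¬x~y →
        ih U′⊂U x∈U′ y∈U′ (≢-sym x≢y , ¬x~y) λ (v , v∈U′ , far-v , simplicial) →
          boundary-dominates (simplicial⇒boundary v∈U′ simplicial) x∈U′ (Far-sym far-v)

      absurd : ⊥
      absurd = component-not-simplicial ε λ x y x∈U′ y∈U′ _ _ → U′-clique x y x∈U′ y∈U′

  far-simplicial : IsChordal G → ∀ {U a w} → a ∈ U → w ∈ U → Far a w → ¬ ¬ FarSimplicial U a
  far-simplicial chordal = go (⊂-wellFounded _)
    where
    go : ∀ {U} → Acc _⊂_ U → ∀ {a w} → a ∈ U → w ∈ U → Far a w → ¬ ¬ FarSimplicial U a
    go {U} (acc smaller) {a} {w} a∈U w∈U far none =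
      ¬¬-comprehension Component λ (C , ∈C⇔) → ¬¬-comprehension Boundary λ (S , ∈S⇔) →
        Step.absurd chordal a∈U (w∈U , far) none (λ U′⊂U → go (smaller U′⊂U)) C ∈C⇔ S ∈S⇔
      where open Separation U a w

  simplicial-vertex : IsChordal G → Fin n → Σ (Fin n) (Simplicial ⊤)
  simplicial-vertex chordal z = decidable-stable (any? (simplicial? ⊤)) λ none →
    none (z , λ x y _ _ _ _ x≢y → decidable-stable (Edge? x y) λ ¬x~y →
      far-simplicial chordal ∈⊤ ∈⊤ (≢-sym x≢y , ¬x~y) λ (v , _ , _ , simplicial) → none (v , simplicial))

  N[_] : Fin n → Subset n
  N[ v ] = proj₁ (comprehension λ u → u ≟ v ⊎-dec Edge? v u)

  ∈N[]⇔ : ∀ {u v} → u ∈ N[ v ] ⇔ (u ≡ v ⊎ Edge G v u)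
  ∈N[]⇔ {u} {v} = proj₂ (comprehension λ u → u ≟ v ⊎-dec Edge? v u) u

  visible-refl : ∀ X a → Visible G X a a
  visible-refl X a = [ a ] , ([] ∷ [] , λ _ _ → z≤n) , λ { _ (here v≡a) _ → inj₁ v≡a }

  Edge⇒visible : ∀ X {a b} → Edge G a b → Visible G X a b
  Edge⇒visible X {a} {b} e =
    (a ∷⟨ e ⟩ [ b ]) , (((Edge⇒≢ e ∷ []) ∷ [] ∷ []) , λ Q _ → nonempty Q) ,
    λ { _ (here v≡a) _ → inj₁ v≡a ; _ (there (here v≡b)) _ → inj₂ v≡b }
    where
    nonempty : (Q : Walk G a b) → 1 ≤ len G Q
    nonempty [ _ ] = contradiction refl (Edge⇒≢ e)
    nonempty (_ ∷⟨ _ ⟩ _) = s≤s z≤n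

  clique⇒mutual-visibility : ∀ {K} → IsClique G K → IsMutualVisibilitySet G K
  clique⇒mutual-visibility {K} K-clique a b a∈K b∈K with a ≟ b
  ... | yes refl = visible-refl K a
  ... | no a≢b = Edge⇒visible K (K-clique a b a∈K b∈K a≢b)

  -- A v,u-path with u ∉ N[v] passes through a neighbour of v, which lies in Y.
  ⊇N[]⇒⊆N[] : ∀ v {Y} → N[ v ] ⊆ Y → IsMutualVisibilitySet G Y → Y ⊆ N[ v ]
  ⊇N[]⇒⊆N[] v {Y} N[v]⊆Y Y-visible {u} u∈Y with u ∈? N[ v ]
  ... | yes u∈N[v] = u∈N[v]
  ... | no u∉N[v] = contradiction (Y-visible v u v∈Y u∈Y) (invisible u∉N[v])
    where
    v∈Y : v ∈ Y
    v∈Y = N[v]⊆Y (from ∈N[]⇔ (inj₁ refl))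

    head∈vertices : ∀ {b c} (P : Walk G b c) → b List.∈ vertices G P
    head∈vertices [ _ ] = here refl
    head∈vertices (_ ∷⟨ _ ⟩ _) = here refl

    invisible : ∀ {u} → u ∉ N[ v ] → ¬ Visible G Y v u
    invisible u∉ ([ _ ] , _) = u∉ (from ∈N[]⇔ (inj₁ refl))
    invisible u∉ ((_ ∷⟨ e ⟩ P) , _ , avoids)
      with avoids _ (there (head∈vertices P)) (N[v]⊆Y (from ∈N[]⇔ (inj₂ e)))
    ... | inj₁ refl = Edge-irrefl e
    ... | inj₂ refl = u∉ (from ∈N[]⇔ (inj₂ e))

  simplicial⇒N[]-clique : ∀ v → Simplicial ⊤ v → IsClique G N[ v ]
  simplicial⇒N[]-clique v simplicial x y x∈N y∈N x≢y with to ∈N[]⇔ x∈N | to ∈N[]⇔ y∈N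
  ... | inj₁ refl | inj₁ refl = contradiction refl x≢y
  ... | inj₁ refl | inj₂ v~y = v~y
  ... | inj₂ v~x | inj₁ refl = Edge-sym v~x
  ... | inj₂ v~x | inj₂ v~y = simplicial x y ∈⊤ ∈⊤ v~x v~y x≢y

  simplicial⇒N[]-maximal : ∀ v → Simplicial ⊤ v → IsMaximalMutualVisibilitySet G N[ v ]
  simplicial⇒N[]-maximal v simplicial =
    clique⇒mutual-visibility (simplicial⇒N[]-clique v simplicial) ,
    λ Y N[v]⊆Y Y-visible → ⊆-antisym (⊇N[]⇒⊆N[] v N[v]⊆Y Y-visible) N[v]⊆Y

corollary2p2 : {n : ℕ} (G : Graph n) → IsChordal G →
    Σ (Subset n) λ X → Σ (Subset n) λ K →
    IsMaximalMutualVisibilitySet G X × IsClique G K × ∣ X ∣ ≤ ∣ K ∣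
corollary2p2 {zero} G _ = [] , [] , ((λ ()) , λ { [] _ _ → refl }) , (λ ()) , z≤n
corollary2p2 {suc n} G chordal =
  let v , simplicial = simplicial-vertex G chordal Fin.zero in
  N[_] G v , N[_] G v ,
  simplicial⇒N[]-maximal G v simplicial , simplicial⇒N[]-clique G v simplicial , ≤-refl
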